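{- A graph $\Gamma$ with diameter $D$ is distance mean-regular if and only if the numbers of triples $t_{hij}(u)$ are well defined (independent of $u$) for all $h,i,j=0,\ldots,D$.
   Context: $\Gamma=(V,E)$ is a finite simple connected graph; $\Gamma_i(u)$ is the set of vertices at distance $i$ from $u$. For a vertex $u$ and $h,i,j\in\{0,\ldots,D\}$, $\overline{p}_{ij}^h(u)=\frac{1}{|\Gamma_h(u)|}\sum_{v\in\Gamma_h(u)}|\Gamma_i(u)\cap\Gamma_j(v)|$; $\Gamma$ is distance mean-regular if these averages are defined and independent of $u$. For fixed $u$, $t_{hij}(u)$ is the number of triples $u,v,w$ (i.e. pairs $(v,w)\in V\times V$) with $\mathrm{dist}(u,v)=h$, $\mathrm{dist}(u,w)=i$ and $\mathrm{dist}(v,w)=j$. -}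

module Defs where

open import Data.Nat using (ℕ; zero; suc; _≤_; _≟_; NonZero)
open import Data.Integer using (+_)
open import Data.Rational using (ℚ; _/_)
open import Data.Bool using (Bool; true; false)
open import Data.Fin using (Fin)
open import Data.List using (List; length; filter; map; allFin; cartesianProduct)
open import Data.Nat.ListAction using (sum)
open import Data.Product using (_×_; _,_; Σ; ∃; ∃-syntax; proj₁; proj₂)
open import Relation.Nullary.Decidable using (_×-dec_)
open import Relation.Binary.PropositionalEquality using (_≡_)

record Graph : Set where
  field
    n     : ℕ
    adj   : Fin n → Fin n → Bool
    sym   : ∀ u v → adj u v ≡ adj v u
    irrfl : ∀ u → adj u u ≡ false

module _ (G : Graph) where
  open Graph G

  data Walk : Fin n → Fin n → ℕ → Set where
    stay : ∀ u → Walk u u zero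
    step : ∀ {u v w k} → adj u v ≡ true → Walk v w k → Walk u w (suc k)

  -- d is the (shortest-path) distance function of G.  The existence of such
  -- a total function means that G is connected.
  IsDistance : (Fin n → Fin n → ℕ) → Set
  IsDistance d = ∀ u v → Walk u v (d u v) × (∀ m → Walk u v m → d u v ≤ m)

  Connected : Set
  Connected = ∀ u v → ∃[ k ] Walk u v k

  module _ (d : Fin n → Fin n → ℕ) where

    IsDiameter : ℕ → Set
    IsDiameter D = (∀ u v → d u v ≤ D) × ∃[ u ] ∃[ v ] d u v ≡ D

    sphereSize : ℕ → Fin n → ℕ
    sphereSize h u = length (filter (λ v → d u v ≟ h) (allFin n))

    pSum : ℕ → ℕ → ℕ → Fin n → ℕ
    pSum h i j u =
      sum (map (λ v → length (filter (λ w → (d u w ≟ i) ×-dec (d v w ≟ j)) (allFin n)))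
               (filter (λ v → d u v ≟ h) (allFin n)))

    pbar : (h i j : ℕ) (u : Fin n) → NonZero (sphereSize h u) → ℚ
    pbar h i j u nz = (+ pSum h i j u) / sphereSize h u
      where instance _ = nz

    t : ℕ → ℕ → ℕ → Fin n → ℕ
    t h i j u = length (filter (λ vw → ((d u (proj₁ vw) ≟ h) ×-dec (d u (proj₂ vw) ≟ i))
                                          ×-dec (d (proj₁ vw) (proj₂ vw) ≟ j))
                               (cartesianProduct (allFin n) (allFin n)))

    DistanceMeanRegular : ℕ → Set
    DistanceMeanRegular D = ∀ h i j → h ≤ D → i ≤ D → j ≤ D →
      Σ (∀ u → NonZero (sphereSize h u)) λ nz →
        ∀ u v → pbar h i j u (nz u) ≡ pbar h i j v (nz v)

    TriplesWellDefined : ℕ → Set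
    TriplesWellDefined D = ∀ h i j → h ≤ D → i ≤ D → j ≤ D →
      ∀ u v → t h i j u ≡ t h i j v

module Submission where

-- The whole argument rests on one counting identity: grouping the pairs
-- (v,w) counted by t_{hij}(u) according to v gives
--     t_{hij}(u) = Σ_{v ∈ Γ_h(u)} |Γ_i(u) ∩ Γ_j(v)| = |Γ_h(u)| · p̄^h_{ij}(u),
-- the numerator of p̄^h_{ij}(u).  Since Γ_0(u) = {u}, the case (0,h,h) says
-- that this numerator for (0,h,h) is |Γ_h(u)|.  Hence
--   * if the p̄ are constant, then so are the |Γ_h(u)| (read off from
--     p̄^0_{hh}(u) = |Γ_h(u)| / 1), hence so are the numerators t_{hij}(u);
--   * if the t_{hij} are constant, then so are |Γ_h(u)| = t_{0hh}(u); these
--     are nonzero for every u because some vertex has a vertex at distance h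
--     (cut a diametral geodesic at length h), so p̄ is defined and constant.

open import Defs
open import Data.Nat using (ℕ; zero; suc; _≤_; _<_; _+_; _∸_; _≟_; NonZero; z≤n; s≤s; >-nonZero)
open import Data.Nat.Properties using (n≤0⇒n≡0; +-identityʳ; ≤-antisym; +-comm; *-cancelʳ-≡; m≤n+o⇒m∸n≤o; m∸[m∸n]≡n)
open import Data.Integer using (+_)
open import Data.Rational using (_/_)
open import Data.Rational.Properties using (normalize-injective-≃; /-cong)
open import Data.Fin using (Fin)
open import Data.Product using (_×_; _,_; Σ; proj₁; proj₂)
open import Data.List using (List; []; _∷_; _++_; length; filter; map; allFin; cartesianProduct)
open import Data.List.Properties using (filter-++; length-++; filter-≐; filter-none)
open import Data.List.Relation.Unary.All using (All; []; _∷_; universal)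
open import Data.List.Relation.Unary.All.Properties using (all-filter)
open import Data.List.Relation.Unary.AllPairs using (_∷_)
open import Data.List.Relation.Unary.Unique.Propositional using (Unique)
open import Data.List.Relation.Unary.Unique.Propositional.Properties using (allFin⁺; filter⁺)
open import Data.List.Membership.Propositional using (_∈_)
open import Data.List.Membership.Propositional.Properties using (∈-allFin; ∈-filter⁺; ∈-length)
open import Data.Nat.ListAction using (sum)
open import Relation.Nullary using (yes; no; contradiction)
open import Relation.Nullary.Decidable using (_×-dec_)
open import Relation.Unary using (Decidable; _≐_)
open import Relation.Binary.PropositionalEquality using (_≡_; refl; sym; trans; cong; cong₂; subst; module ≡-Reasoning)

unique-constant⇒singleton : {A : Set} {x : A} {xs : List A} →
  Unique xs → All (_≡ x) xs → x ∈ xs → xs ≡ x ∷ []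
unique-constant⇒singleton {xs = y ∷ []} _ (refl ∷ []) _ = refl
unique-constant⇒singleton {xs = y ∷ z ∷ _} ((y≢z ∷ _) ∷ _) (refl ∷ refl ∷ _) _ =
  contradiction refl y≢z

length-filter-map : {A B : Set} {P : B → Set} (P? : Decidable P) (f : A → B) (xs : List A) →
  length (filter P? (map f xs)) ≡ length (filter (λ x → P? (f x)) xs)
length-filter-map P? f [] = refl
length-filter-map P? f (x ∷ xs) with P? (f x)
... | yes _ = cong suc (length-filter-map P? f xs)
... | no  _ = length-filter-map P? f xs

count-pairs : {A B : Set} {P : A → Set} {Q : A → B → Set}
  (P? : Decidable P) (Q? : ∀ x → Decidable (Q x)) (xs : List A) (ys : List B) →
  length (filter (λ xy → P? (proj₁ xy) ×-dec Q? (proj₁ xy) (proj₂ xy)) (cartesianProduct xs ys))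
    ≡ sum (map (λ x → length (filter (Q? x) ys)) (filter P? xs))
count-pairs P? Q? [] ys = refl
count-pairs {A} {B} {P} {Q} P? Q? (x ∷ xs) ys = begin
  length (filter R (map (x ,_) ys ++ cartesianProduct xs ys))
    ≡⟨ cong length (filter-++ R (map (x ,_) ys) (cartesianProduct xs ys)) ⟩
  length (filter R (map (x ,_) ys) ++ filter R (cartesianProduct xs ys))
    ≡⟨ length-++ (filter R (map (x ,_) ys)) ⟩
  length (filter R (map (x ,_) ys)) + length (filter R (cartesianProduct xs ys))
    ≡⟨ cong₂ _+_ (length-filter-map R (x ,_) ys) (count-pairs P? Q? xs ys) ⟩
  length (filter (λ y → P? x ×-dec Q? x y) ys) + rest
    ≡⟨ first-row ⟩
  sum (map count (filter P? (x ∷ xs)))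
    ∎
  where
    open ≡-Reasoning
    R : Decidable (λ (xy : A × B) → P (proj₁ xy) × Q (proj₁ xy) (proj₂ xy))
    R xy = P? (proj₁ xy) ×-dec Q? (proj₁ xy) (proj₂ xy)

    count : A → ℕ
    count x = length (filter (Q? x) ys)

    rest : ℕ
    rest = sum (map count (filter P? xs))

    first-row : length (filter (λ y → P? x ×-dec Q? x y) ys) + rest
                  ≡ sum (map count (filter P? (x ∷ xs)))
    first-row with P? x
    ... | yes px = cong (λ c → length c + rest) (filter-≐ _ (Q? x) (proj₂ , (px ,_)) ys)
    ... | no ¬px = cong (λ c → length c + rest) (filter-none _ (universal (λ _ pq → ¬px (proj₁ pq)) ys))

numerators-≡ : ∀ p q a b {{a≢0 : NonZero a}} {{b≢0 : NonZero b}} →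
  a ≡ b → (+ p) / a ≡ (+ q) / b → p ≡ q
numerators-≡ p q a .a {{a≢0}} {{a≢0′}} refl eq =
  *-cancelʳ-≡ p q a {{a≢0}} (normalize-injective-≃ p q a a {{a≢0}} {{a≢0′}} eq)

module Walks (G : Graph) where
  open Graph G using (n)

  walk-split : ∀ {a b m} k → k ≤ m → Walk G a b m →
    Σ (Fin n) λ c → Walk G a c k × Walk G c b (m ∸ k)
  walk-split {a} zero _ w = a , stay a , w
  walk-split (suc k) (s≤s k≤m) (step e w) with walk-split k k≤m w
  ... | c , p , q = c , step e p , q

  walk-++ : ∀ {a b c k l} → Walk G a c k → Walk G c b l → Walk G a b (k + l)
  walk-++ (stay _) q = q
  walk-++ (step e p) q = step e (walk-++ p q)

-- Facts about a graph with a distance function d.  (Connectivity of the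
-- graph is implicit in d being a total distance function.)
module Distances (G : Graph) (d : Fin (Graph.n G) → Fin (Graph.n G) → ℕ) (isD : IsDistance G d) where
  open Graph G using (n)
  open Walks G

  geodesic : ∀ u v → Walk G u v (d u v)
  geodesic u v = proj₁ (isD u v)

  shortest : ∀ {u v m} → Walk G u v m → d u v ≤ m
  shortest {u} {v} {m} w = proj₂ (isD u v) m w

  dist-self : ∀ u → d u u ≡ 0
  dist-self u = n≤0⇒n≡0 (shortest (stay u))

  dist≡0⇒≡ : ∀ {u v} → d u v ≡ 0 → u ≡ v
  dist≡0⇒≡ {u} {v} duv≡0 with subst (Walk G u v) duv≡0 (geodesic u v)
  ... | stay _ = refl

  dist-via : ∀ {a b c l} → Walk G c b l → d a b ≤ d a c + l
  dist-via {a} {c = c} q = shortest (walk-++ (geodesic a c) q)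

  sphere : ℕ → Fin n → List (Fin n)
  sphere h u = filter (λ v → d u v ≟ h) (allFin n)

  sphere-zero : ∀ u → sphere 0 u ≡ u ∷ []
  sphere-zero u = unique-constant⇒singleton
    (filter⁺ (λ v → d u v ≟ 0) (allFin⁺ n))
    (mapAll (all-filter (λ v → d u v ≟ 0) (allFin n)))
    (∈-filter⁺ (λ v → d u v ≟ 0) (∈-allFin u) (dist-self u))
    where
      mapAll : ∀ {vs} → All (λ v → d u v ≡ 0) vs → All (_≡ u) vs
      mapAll [] = []
      mapAll (e ∷ es) = sym (dist≡0⇒≡ e) ∷ mapAll es

  sphereSize-zero : ∀ u → sphereSize G d 0 u ≡ 1
  sphereSize-zero u = cong length (sphere-zero u)

  triples≡pSum : ∀ h i j u → t G d h i j u ≡ pSum G d h i j u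
  triples≡pSum h i j u = trans
    (cong length (filter-≐ _ (λ vw → P? (proj₁ vw) ×-dec Q? (proj₁ vw) (proj₂ vw)) reassoc
                   (cartesianProduct (allFin n) (allFin n))))
    (count-pairs P? Q? (allFin n) (allFin n))
    where
      P? : Decidable (λ v → d u v ≡ h)
      P? v = d u v ≟ h

      Q? : ∀ v → Decidable (λ w → d u w ≡ i × d v w ≡ j)
      Q? v w = (d u w ≟ i) ×-dec (d v w ≟ j)

      -- t groups its three conditions as (h ∧ i) ∧ j; counting by v needs h ∧ (i ∧ j)
      reassoc : (λ (vw : Fin n × Fin n) → (d u (proj₁ vw) ≡ h × d u (proj₂ vw) ≡ i) × d (proj₁ vw) (proj₂ vw) ≡ j)
              ≐ (λ vw → d u (proj₁ vw) ≡ h × d u (proj₂ vw) ≡ i × d (proj₁ vw) (proj₂ vw) ≡ j)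
      reassoc = (λ { ((a , b) , c) → a , b , c }) , (λ { (a , b , c) → (a , b) , c })

  -- Since Γ_0(u) = {u}: Σ_{v ∈ Γ_0(u)} |Γ_h(u) ∩ Γ_h(v)| = |Γ_h(u)|.
  pSum-0hh : ∀ h u → pSum G d 0 h h u ≡ sphereSize G d h u
  pSum-0hh h u = begin
    pSum G d 0 h h u
      ≡⟨ cong (λ vs → sum (map (λ v → length (filter (λ w → (d u w ≟ h) ×-dec (d v w ≟ h)) (allFin n))) vs))
              (sphere-zero u) ⟩
    length (filter (λ w → (d u w ≟ h) ×-dec (d u w ≟ h)) (allFin n)) + 0
      ≡⟨ +-identityʳ _ ⟩
    length (filter (λ w → (d u w ≟ h) ×-dec (d u w ≟ h)) (allFin n))
      ≡⟨ cong length (filter-≐ _ (λ w → d u w ≟ h) (proj₁ , (λ e → e , e)) (allFin n)) ⟩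
    sphereSize G d h u
      ∎
    where open ≡-Reasoning

  -- Every distance h ≤ D is realised: cutting a diametral geodesic after h
  -- steps gives a vertex at distance exactly h from its start.
  sphere-inhabited : ∀ {D} → IsDiameter G d D → ∀ {h} → h ≤ D →
    Σ (Fin n) λ u → 0 < sphereSize G d h u
  sphere-inhabited {D} (_ , a , b , dab≡D) {h} h≤D
    with walk-split h h≤D (subst (Walk G a b) dab≡D (geodesic a b))
  ... | c , p , q = a , ∈-length (∈-filter⁺ (λ v → d a v ≟ h) (∈-allFin c) dac≡h)
    where
      D≤ : D ≤ (D ∸ h) + d a c
      D≤ = subst (_≤ (D ∸ h) + d a c) dab≡D (subst (d a b ≤_) (+-comm (d a c) (D ∸ h)) (dist-via q))
      dac≡h : d a c ≡ h
      dac≡h = ≤-antisym (shortest p) (subst (_≤ d a c) (m∸[m∸n]≡n h≤D) (m≤n+o⇒m∸n≤o D (D ∸ h) D≤))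

  sphereSize≡t-0hh : ∀ h u → sphereSize G d h u ≡ t G d 0 h h u
  sphereSize≡t-0hh h u = sym (trans (triples≡pSum 0 h h u) (pSum-0hh h u))

  -- If the averages p̄ are constant, then |Γ_h(u)| = p̄^0_{hh}(u) is
  -- constant, so the numerators t_{hij}(u) = |Γ_h(u)| p̄^h_{ij}(u) are too.
  meanRegular⇒triples : ∀ D → DistanceMeanRegular G d D → TriplesWellDefined G d D
  meanRegular⇒triples D dmr h i j h≤D i≤D j≤D u v = begin
    t G d h i j u     ≡⟨ triples≡pSum h i j u ⟩
    pSum G d h i j u  ≡⟨ numerators-≡ _ _ _ _ {{nz u}} {{nz v}} sizes≡ (pbar≡ u v) ⟩
    pSum G d h i j v  ≡⟨ triples≡pSum h i j v ⟨
    t G d h i j v     ∎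
    where
      open ≡-Reasoning
      nz : ∀ w → NonZero (sphereSize G d h w)
      nz = proj₁ (dmr h i j h≤D i≤D j≤D)

      pbar≡ : ∀ w w′ → pbar G d h i j w (nz w) ≡ pbar G d h i j w′ (nz w′)
      pbar≡ = proj₂ (dmr h i j h≤D i≤D j≤D)

      nz₀ : ∀ w → NonZero (sphereSize G d 0 w)
      nz₀ = proj₁ (dmr 0 h h z≤n h≤D h≤D)

      pbar₀≡ : ∀ w w′ → pbar G d 0 h h w (nz₀ w) ≡ pbar G d 0 h h w′ (nz₀ w′)
      pbar₀≡ = proj₂ (dmr 0 h h z≤n h≤D h≤D)

      sizes≡ : sphereSize G d h u ≡ sphereSize G d h v
      sizes≡ = begin
        sphereSize G d h u  ≡⟨ pSum-0hh h u ⟨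
        pSum G d 0 h h u    ≡⟨ numerators-≡ _ _ _ _ {{nz₀ u}} {{nz₀ v}}
                                 (trans (sphereSize-zero u) (sym (sphereSize-zero v))) (pbar₀≡ u v) ⟩
        pSum G d 0 h h v    ≡⟨ pSum-0hh h v ⟩
        sphereSize G d h v  ∎

  -- If the t_{hij} are constant, then so are the |Γ_h(u)| = t_{0hh}(u);
  -- they are nonzero because some Γ_h(u) is inhabited, so p̄ is defined and,
  -- as a quotient of constants, constant.
  triples⇒meanRegular : ∀ D → IsDiameter G d D → TriplesWellDefined G d D → DistanceMeanRegular G d D
  triples⇒meanRegular D diam twd h i j h≤D i≤D j≤D = nz , λ u v →
    /-cong {{nz u}} {{nz v}} (cong +_ (numerators≡ u v)) (sizes≡ u v)
    where
      sizes≡ : ∀ u v → sphereSize G d h u ≡ sphereSize G d h v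
      sizes≡ u v = trans (sphereSize≡t-0hh h u)
                     (trans (twd 0 h h z≤n h≤D h≤D u v) (sym (sphereSize≡t-0hh h v)))

      numerators≡ : ∀ u v → pSum G d h i j u ≡ pSum G d h i j v
      numerators≡ u v = trans (sym (triples≡pSum h i j u))
                          (trans (twd h i j h≤D i≤D j≤D u v) (triples≡pSum h i j v))

      nz : ∀ u → NonZero (sphereSize G d h u)
      nz u with sphere-inhabited diam h≤D
      ... | a , 0<size = >-nonZero (subst (0 <_) (sizes≡ a u) 0<size)

mainTheorem6 : (G : Graph) → Connected G → (d : Fin (Graph.n G) → Fin (Graph.n G) → ℕ) → IsDistance G d → (D : ℕ) → IsDiameter G d D →
    (DistanceMeanRegular G d D → TriplesWellDefined G d D) × (TriplesWellDefined G d D → DistanceMeanRegular G d D)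
mainTheorem6 G _ d isD D diam = meanRegular⇒triples D , triples⇒meanRegular D diam
  where open Distances G d isD
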